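{- $f_C\circ u=f_R\circ u$, i.e. $f_C(u(R))=f_R(u(R))$ for every conditional relation $R$.
   Context: Composition of $f\colon A\to B$, $g\colon B\to C$ is written $f;g$. Fix a category $\mathbf C$ with distinguished object $0$ and a representative class $\kappa$ of commuting squares: for every commuting square $\alpha_1;\delta_1=\alpha_2;\delta_2$ there are $(\alpha_1,\alpha_2,\beta_1,\beta_2)\in\kappa$ (a commuting square) and $\gamma$ with $\delta_1=\beta_1;\gamma$, $\delta_2=\beta_2;\gamma$; $\kappa(\alpha_1,\alpha_2)$ is the set of $(\beta_1,\beta_2)$ with $(\alpha_1,\alpha_2,\beta_1,\beta_2)\in\kappa$. Conditions over $A$ are defined inductively as $(A,\mathcal Q,S)$, $\mathcal Q\in\{\forall,\exists\}$, $S$ a finite set of pairs $(h,\mathcal A')$ with $h\colon A\to A'$, $\mathcal A'$ a condition over $A'$. For $a\colon A\to B$: $a\models(A,\forall,S)$ iff for all $(h,\mathcal A')\in S$ and all $g$ with $a=h;g$, $g\models\mathcal A'$; $a\models(A,\exists,S)$ iff some $(h,\mathcal A')\in S$ and $g$ satisfy $a=h;g$, $g\models\mathcal A'$. $\mathcal A\models\mathcal B$: every arrow satisfying $\mathcal A$ satisfies $\mathcal B$. Boolean connectives have the standard semantics. Shift along $c\colon A\to B$: $(A,\mathcal Q,S)_{\downarrow c}=(B,\mathcal Q,\{(\beta,\mathcal A'_{\downarrow\alpha})\mid(h,\mathcal A')\in S,(\alpha,\beta)\in\kappa(h,c)\})$; it satisfies $c;d\models\mathcal A\iff d\models\mathcal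 A_{\downarrow c}$. A conditional reactive system is a set $\mathcal S$ of rules $(\ell,r,\mathcal R)$, $\ell,r\colon0\to I$, $\mathcal R$ a condition over $I$. Context step $a\xrightarrow[C]{f,\ \mathcal A}a'$ ($a\colon0\to J$, $f\colon J\to K$, $a'\colon0\to K$, $\mathcal A$ over $K$): there are a rule $(\ell,r,\mathcal R)\in\mathcal S$ and $c\colon I\to K$ with $a;f=\ell;c$, $a'=r;c$, $\mathcal A\models\mathcal R_{\downarrow c}$. Representative step $a\xrightarrow[R]{f,\ \mathcal A}a'$: a context step with additionally $(f,c)\in\kappa(a,\ell)$ and $\mathcal A=\mathcal R_{\downarrow c}$. A conditional relation is a set of triples $(a,b,\mathcal C)$, $a,b\colon0\to J$, $\mathcal C$ a condition over $J$. $\mathcal D\models\bigvee_{i\in I}\mathcal E_i$ (possibly infinite $I$): every arrow satisfying $\mathcal D$ satisfies some $\mathcal E_i$. $u(R)=\{(a;d,\ b;d,\ \mathcal C_{\downarrow d})\mid(a,b,\mathcal C)\in R,\ a,b\colon0\to J,\ d\colon J\to K\}$. $f_C(R)$ is the set of triples $(a,b,\mathcal C)$ such that for each context step $a\xrightarrow[C]{f,\ \mathcal A}a'$ there are an index set $I$, context steps $b\xrightarrow[C]{f,\ \mathcal B_i}b'_i$ and conditions $\mathcal C'_i$ with $(a',b'_i,\mathcal C'_i)\in R$ and $\mathcal A\land\mathcal C_{\downarrow f}\models\bigvee_{i\in I}(\mathcal C'_i\land\mathcal B_i)$, and symmetrically each context step of $b$ is answered by context steps of $a$. $f_R(R)$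 is defined identically except that only representative steps of $a$ (resp. of $b$) must be answered (still by context steps). -}

module Defs where

open import Level using (Level; _⊔_; suc)
open import Data.Product using (Σ; Σ-syntax; _×_; _,_)
open import Data.Sum using (_⊎_)
open import Data.Unit.Polymorphic using (⊤)
open import Data.Empty.Polymorphic using (⊥)
open import Data.List using (List; []; _∷_; _++_)
open import Data.List.Membership.Propositional using (_∈_)
open import Relation.Binary.PropositionalEquality using (_≡_)
open import Function.Bundles using (_⇔_)

-- Composition is written in diagrammatic order:  f ⨾ g  (= f;g in the paper).
record Category (o ℓ : Level) : Set (suc (o ⊔ ℓ)) where
  infixl 20 _⨾_
  field
    Obj   : Set o
    Hom   : Obj → Obj → Set ℓ
    id    : ∀ {A} → Hom A A
    _⨾_   : ∀ {A B C} → Hom A B → Hom B C → Hom A C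
    idˡ   : ∀ {A B} (f : Hom A B) → id ⨾ f ≡ f
    idʳ   : ∀ {A B} (f : Hom A B) → f ⨾ id ≡ f
    assoc : ∀ {A B C D} (f : Hom A B) (g : Hom B C) (h : Hom C D) →
            (f ⨾ g) ⨾ h ≡ f ⨾ (g ⨾ h)

-- The ambient data: a category C, a distinguished object 0 and a
-- representative class κ of commuting squares.  κ(α₁,α₂) is given as a
-- finite list of completions (D , β₁ , β₂) (finiteness is needed so that the
-- shift of a condition is again a condition with a finite set of branches).
record Setting (o ℓ : Level) : Set (suc (o ⊔ ℓ)) where
  field
    cat : Category o ℓ
  open Category cat public
  field
    𝟘 : Obj
    κ : ∀ {A B₁ B₂} → Hom A B₁ → Hom A B₂ →
        List (Σ[ D ∈ Obj ] (Hom B₁ D × Hom B₂ D))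
    κ-commutes : ∀ {A B₁ B₂} (α₁ : Hom A B₁) (α₂ : Hom A B₂)
                   {D} (β₁ : Hom B₁ D) (β₂ : Hom B₂ D) →
                 (D , β₁ , β₂) ∈ κ α₁ α₂ → α₁ ⨾ β₁ ≡ α₂ ⨾ β₂
    κ-represents : ∀ {A B₁ B₂ E} (α₁ : Hom A B₁) (α₂ : Hom A B₂)
                     (δ₁ : Hom B₁ E) (δ₂ : Hom B₂ E) →
                   α₁ ⨾ δ₁ ≡ α₂ ⨾ δ₂ →
                   Σ[ D ∈ Obj ] Σ[ β₁ ∈ Hom B₁ D ] Σ[ β₂ ∈ Hom B₂ D ]
                     ((D , β₁ , β₂) ∈ κ α₁ α₂ ×
                      Σ[ γ ∈ Hom D E ] (δ₁ ≡ β₁ ⨾ γ × δ₂ ≡ β₂ ⨾ γ))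

module Theory {o ℓ : Level} (𝒳 : Setting o ℓ) where
  open Setting 𝒳

  data Quant : Set where
    ∀Q ∃Q : Quant

  -- Conditions over A: (A , Q , S) with S a finite set (list) of pairs (h , A').
  mutual
    data Cond (A : Obj) : Set (o ⊔ ℓ) where
      cond : Quant → List (Branch A) → Cond A

    data Branch (A : Obj) : Set (o ⊔ ℓ) where
      br : {A' : Obj} → Hom A A' → Cond A' → Branch A

  mutual
    _⊨_ : ∀ {A B} → Hom A B → Cond A → Set (o ⊔ ℓ)
    a ⊨ cond ∀Q S = ⊨∀ a S
    a ⊨ cond ∃Q S = ⊨∃ a S

    ⊨∀ : ∀ {A B} → Hom A B → List (Branch A) → Set (o ⊔ ℓ)
    ⊨∀ a [] = ⊤
    ⊨∀ {B = B} a (br {A'} h 𝒜' ∷ S) =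
      ((g : Hom A' B) → a ≡ h ⨾ g → g ⊨ 𝒜') × ⊨∀ a S

    ⊨∃ : ∀ {A B} → Hom A B → List (Branch A) → Set (o ⊔ ℓ)
    ⊨∃ a [] = ⊥
    ⊨∃ {B = B} a (br {A'} h 𝒜' ∷ S) =
      (Σ[ g ∈ Hom A' B ] (a ≡ h ⨾ g × g ⊨ 𝒜')) ⊎ ⊨∃ a S

  _⊨ᶜ_ : ∀ {A} → Cond A → Cond A → Set (o ⊔ ℓ)
  _⊨ᶜ_ {A} 𝒜 ℬ = ∀ {B} (a : Hom A B) → a ⊨ 𝒜 → a ⊨ ℬ

  mutual
    _↓_ : ∀ {A B} → Cond A → Hom A B → Cond B
    cond Q S ↓ c = cond Q (shiftList S c)

    shiftList : ∀ {A B} → List (Branch A) → Hom A B → List (Branch B)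
    shiftList [] c = []
    shiftList (br h 𝒜' ∷ S) c = shiftSquares 𝒜' (κ h c) ++ shiftList S c

    shiftSquares : ∀ {A' B} → Cond A' →
                   List (Σ[ D ∈ Obj ] (Hom A' D × Hom B D)) → List (Branch B)
    shiftSquares 𝒜' [] = []
    shiftSquares 𝒜' ((D , α , β) ∷ L) = br β (𝒜' ↓ α) ∷ shiftSquares 𝒜' L

  record Rule : Set (o ⊔ ℓ) where
    constructor rule
    field
      I : Obj
      lhs rhs : Hom 𝟘 I
      cnd : Cond I

  ReactiveSystem : Set (suc (o ⊔ ℓ))
  ReactiveSystem = Rule → Set (o ⊔ ℓ)

  module _ (𝒮 : ReactiveSystem) where

    CStep : ∀ {J K} → Hom 𝟘 J → Hom J K → Cond K → Hom 𝟘 K → Set (o ⊔ ℓ)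
    CStep {J} {K} a f 𝒜 a' =
      Σ[ I ∈ Obj ] Σ[ ℓ' ∈ Hom 𝟘 I ] Σ[ r ∈ Hom 𝟘 I ] Σ[ ℛ ∈ Cond I ]
        (𝒮 (rule I ℓ' r ℛ) × Σ[ c ∈ Hom I K ]
          (a ⨾ f ≡ ℓ' ⨾ c × a' ≡ r ⨾ c × 𝒜 ⊨ᶜ (ℛ ↓ c)))

    RStep : ∀ {J K} → Hom 𝟘 J → Hom J K → Cond K → Hom 𝟘 K → Set (o ⊔ ℓ)
    RStep {J} {K} a f 𝒜 a' =
      Σ[ I ∈ Obj ] Σ[ ℓ' ∈ Hom 𝟘 I ] Σ[ r ∈ Hom 𝟘 I ] Σ[ ℛ ∈ Cond I ]
        (𝒮 (rule I ℓ' r ℛ) × Σ[ c ∈ Hom I K ]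
          (a ⨾ f ≡ ℓ' ⨾ c × a' ≡ r ⨾ c × 𝒜 ⊨ᶜ (ℛ ↓ c) ×
           (K , f , c) ∈ κ a ℓ' × 𝒜 ≡ ℛ ↓ c))

    record Triple : Set (o ⊔ ℓ) where
      constructor triple
      field
        J : Obj
        fst snd : Hom 𝟘 J
        cnd : Cond J

    CRel : Set (suc (o ⊔ ℓ))
    CRel = Triple → Set (o ⊔ ℓ)

    u : CRel → CRel
    u R (triple K x y 𝒟) =
      Σ[ J ∈ Obj ] Σ[ a ∈ Hom 𝟘 J ] Σ[ b ∈ Hom 𝟘 J ] Σ[ 𝒞 ∈ Cond J ]
        (R (triple J a b 𝒞) × Σ[ d ∈ Hom J K ]
          (x ≡ a ⨾ d × y ≡ b ⨾ d × 𝒟 ≡ 𝒞 ↓ d))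

    -- 𝒜 ∧ 𝒞 ⊨ ⋁_{i∈I} (𝒞'ᵢ ∧ ℬᵢ)   (Boolean connectives read semantically)
    EntailsBigOr : ∀ {K} (𝒜 𝒞 : Cond K) (I : Set (o ⊔ ℓ)) (𝒞' ℬ : I → Cond K) →
                   Set (o ⊔ ℓ)
    EntailsBigOr {K} 𝒜 𝒞 I 𝒞' ℬ =
      ∀ {X} (x : Hom K X) → x ⊨ 𝒜 → x ⊨ 𝒞 →
        Σ[ i ∈ I ] (x ⊨ 𝒞' i × x ⊨ ℬ i)

    AnsweredL : CRel → ∀ {J K} → Hom 𝟘 J → Cond J → Hom J K → Cond K → Hom 𝟘 K →
                Set (suc (o ⊔ ℓ))
    AnsweredL R {J} {K} b 𝒞 f 𝒜 a' =
      Σ[ I ∈ Set (o ⊔ ℓ) ] Σ[ b' ∈ (I → Hom 𝟘 K) ] Σ[ ℬ ∈ (I → Cond K) ]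
      Σ[ 𝒞' ∈ (I → Cond K) ]
        ((∀ i → CStep b f (ℬ i) (b' i)) ×
         (∀ i → R (triple K a' (b' i) (𝒞' i))) ×
         EntailsBigOr 𝒜 (𝒞 ↓ f) I 𝒞' ℬ)

    AnsweredR : CRel → ∀ {J K} → Hom 𝟘 J → Cond J → Hom J K → Cond K → Hom 𝟘 K →
                Set (suc (o ⊔ ℓ))
    AnsweredR R {J} {K} a 𝒞 f ℬ b' =
      Σ[ I ∈ Set (o ⊔ ℓ) ] Σ[ a' ∈ (I → Hom 𝟘 K) ] Σ[ 𝒜 ∈ (I → Cond K) ]
      Σ[ 𝒞' ∈ (I → Cond K) ]
        ((∀ i → CStep a f (𝒜 i) (a' i)) ×
         (∀ i → R (triple K (a' i) b' (𝒞' i))) ×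
         EntailsBigOr ℬ (𝒞 ↓ f) I 𝒞' 𝒜)

    fC : CRel → Triple → Set (suc (o ⊔ ℓ))
    fC R (triple J a b 𝒞) =
      (∀ {K} (f : Hom J K) (𝒜 : Cond K) (a' : Hom 𝟘 K) →
         CStep a f 𝒜 a' → AnsweredL R b 𝒞 f 𝒜 a') ×
      (∀ {K} (f : Hom J K) (ℬ : Cond K) (b' : Hom 𝟘 K) →
         CStep b f ℬ b' → AnsweredR R a 𝒞 f ℬ b')

    fR : CRel → Triple → Set (suc (o ⊔ ℓ))
    fR R (triple J a b 𝒞) =
      (∀ {K} (f : Hom J K) (𝒜 : Cond K) (a' : Hom 𝟘 K) →
         RStep a f 𝒜 a' → AnsweredL R b 𝒞 f 𝒜 a') ×
      (∀ {K} (f : Hom J K) (ℬ : Cond K) (b' : Hom 𝟘 K) →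
         RStep b f ℬ b' → AnsweredR R a 𝒞 f ℬ b')

    _≐_ : (Triple → Set (suc (o ⊔ ℓ))) → (Triple → Set (suc (o ⊔ ℓ))) →
          Set (suc (o ⊔ ℓ))
    P ≐ Q = ∀ t → P t ⇔ Q t

module Submission where

-- A context step  a --[f , 𝒜]--> a'  factors through a
-- representative step: by representativity of κ for the square a⨾f = ℓ⨾c
-- there are  (f' , c') ∈ κ(a , ℓ)  and  γ  with  f = f'⨾γ , c = c'⨾γ , so the
-- step is the representative step  a --[f' , ℛ↓c']--> r⨾c'  put into the
-- context γ.  Context steps and relations of the form u(R) are both closed
-- under putting into a context, hence any answer to the representative step
-- yields an answer to the original context step.  So f_R(R') ⊆ f_C(R') for
-- every context-closed relation R'; the converse holds for every relation
-- because representative steps are context steps.  As u(R) is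
-- context-closed, f_C(u(R)) = f_R(u(R)).

open import Defs
open import Level using (Level; _⊔_)
open import Data.Product using (Σ-syntax; _×_; _,_)
open import Data.Sum using (_⊎_; inj₁; inj₂)
open import Data.Unit.Polymorphic using (tt)
open import Data.List using (List; []; _∷_; _++_)
open import Data.List.Membership.Propositional using (_∈_)
open import Data.List.Relation.Unary.Any using (here; there)
open import Relation.Binary.PropositionalEquality
  using (_≡_; refl; sym; trans; cong; subst; subst₂; module ≡-Reasoning)
open import Function.Bundles using (mk⇔)

module _ {o ℓ : Level} (𝒳 : Setting o ℓ) where
  open Setting 𝒳
  open Theory 𝒳

  ⨾-extend : ∀ {A B B' C D} {f : Hom A B} {g : Hom B C} {h : Hom A B'} {k : Hom B' C}
             (x : Hom C D) → f ⨾ g ≡ h ⨾ k → f ⨾ (g ⨾ x) ≡ h ⨾ (k ⨾ x)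
  ⨾-extend {f = f} {g} {h} {k} x eq = begin
    f ⨾ (g ⨾ x)  ≡⟨ sym (assoc f g x) ⟩
    (f ⨾ g) ⨾ x  ≡⟨ cong (_⨾ x) eq ⟩
    (h ⨾ k) ⨾ x  ≡⟨ assoc h k x ⟩
    h ⨾ (k ⨾ x)  ∎
    where open ≡-Reasoning

  ⊨∀-++⁺ : ∀ {A B} {d : Hom A B} (S T : List (Branch A)) →
           ⊨∀ d S → ⊨∀ d T → ⊨∀ d (S ++ T)
  ⊨∀-++⁺ []            T _         dT = dT
  ⊨∀-++⁺ (br h 𝒜' ∷ S) T (dh , dS) dT = dh , ⊨∀-++⁺ S T dS dT

  ⊨∀-++⁻ : ∀ {A B} {d : Hom A B} (S T : List (Branch A)) →
           ⊨∀ d (S ++ T) → ⊨∀ d S × ⊨∀ d T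
  ⊨∀-++⁻ []            T dT = tt , dT
  ⊨∀-++⁻ (br h 𝒜' ∷ S) T (dh , dST) with ⊨∀-++⁻ S T dST
  ... | dS , dT = (dh , dS) , dT

  ⊨∃-++ˡ : ∀ {A B} {d : Hom A B} (S T : List (Branch A)) → ⊨∃ d S → ⊨∃ d (S ++ T)
  ⊨∃-++ˡ (br h 𝒜' ∷ S) T (inj₁ dh) = inj₁ dh
  ⊨∃-++ˡ (br h 𝒜' ∷ S) T (inj₂ dS) = inj₂ (⊨∃-++ˡ S T dS)

  ⊨∃-++ʳ : ∀ {A B} {d : Hom A B} (S T : List (Branch A)) → ⊨∃ d T → ⊨∃ d (S ++ T)
  ⊨∃-++ʳ []            T dT = dT
  ⊨∃-++ʳ (br h 𝒜' ∷ S) T dT = inj₂ (⊨∃-++ʳ S T dT)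

  ⊨∃-++⁻ : ∀ {A B} {d : Hom A B} (S T : List (Branch A)) →
           ⊨∃ d (S ++ T) → ⊨∃ d S ⊎ ⊨∃ d T
  ⊨∃-++⁻ []            T dT        = inj₂ dT
  ⊨∃-++⁻ (br h 𝒜' ∷ S) T (inj₁ dh) = inj₁ (inj₁ dh)
  ⊨∃-++⁻ (br h 𝒜' ∷ S) T (inj₂ dST) with ⊨∃-++⁻ S T dST
  ... | inj₁ dS = inj₁ (inj₂ dS)
  ... | inj₂ dT = inj₂ dT

  Squares : Obj → Obj → Set (o ⊔ ℓ)
  Squares A' B = List (Σ[ D ∈ Obj ] (Hom A' D × Hom B D))

  ⊨∀-squares⁺ : ∀ {A' B C} (𝒜' : Cond A') {d : Hom B C} (L : Squares A' B) →
                (∀ {D α β} → (D , α , β) ∈ L → (g : Hom D C) → d ≡ β ⨾ g → g ⊨ (𝒜' ↓ α)) →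
                ⊨∀ d (shiftSquares 𝒜' L)
  ⊨∀-squares⁺ 𝒜' []      all = tt
  ⊨∀-squares⁺ 𝒜' (_ ∷ L) all = all (here refl) , ⊨∀-squares⁺ 𝒜' L (λ m → all (there m))

  ⊨∀-squares⁻ : ∀ {A' B C} (𝒜' : Cond A') {d : Hom B C} (L : Squares A' B) →
                ⊨∀ d (shiftSquares 𝒜' L) →
                ∀ {D α β} → (D , α , β) ∈ L → (g : Hom D C) → d ≡ β ⨾ g → g ⊨ (𝒜' ↓ α)
  ⊨∀-squares⁻ 𝒜' (_ ∷ L) (dh , dL) (here refl) = dh
  ⊨∀-squares⁻ 𝒜' (_ ∷ L) (dh , dL) (there m)   = ⊨∀-squares⁻ 𝒜' L dL m

  ⊨∃-squares⁺ : ∀ {A' B C} (𝒜' : Cond A') {d : Hom B C} (L : Squares A' B) →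
                ∀ {D α β} → (D , α , β) ∈ L → (g : Hom D C) → d ≡ β ⨾ g → g ⊨ (𝒜' ↓ α) →
                ⊨∃ d (shiftSquares 𝒜' L)
  ⊨∃-squares⁺ 𝒜' (_ ∷ L) (here refl) g eq s = inj₁ (g , eq , s)
  ⊨∃-squares⁺ 𝒜' (_ ∷ L) (there m)   g eq s = inj₂ (⊨∃-squares⁺ 𝒜' L m g eq s)

  ⊨∃-squares⁻ : ∀ {A' B C} (𝒜' : Cond A') {d : Hom B C} (L : Squares A' B) →
                ⊨∃ d (shiftSquares 𝒜' L) →
                Σ[ D ∈ Obj ] Σ[ α ∈ Hom A' D ] Σ[ β ∈ Hom B D ] ((D , α , β) ∈ L ×
                  Σ[ g ∈ Hom D C ] (d ≡ β ⨾ g × g ⊨ (𝒜' ↓ α)))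
  ⊨∃-squares⁻ 𝒜' ((D , α , β) ∷ L) (inj₁ (g , eq , s)) = D , α , β , here refl , g , eq , s
  ⊨∃-squares⁻ 𝒜' (_ ∷ L) (inj₂ dL) with ⊨∃-squares⁻ 𝒜' L dL
  ... | D , α , β , m , g , eq , s = D , α , β , there m , g , eq , s

  -- Arrows g with
  -- c⨾d = h⨾g correspond, via representativity of κ(h , c), to arrows
  -- factoring d through a representative square; the list-level lemmas
  -- treat one quantifier each and recurse into the sub-conditions.
  mutual
    shift⁺ : ∀ {A B C} (𝒜 : Cond A) (c : Hom A B) (d : Hom B C) →
             (c ⨾ d) ⊨ 𝒜 → d ⊨ (𝒜 ↓ c)
    shift⁺ (cond ∀Q S) c d = shift-∀⁺ S c d
    shift⁺ (cond ∃Q S) c d = shift-∃⁺ S c d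

    shift⁻ : ∀ {A B C} (𝒜 : Cond A) (c : Hom A B) (d : Hom B C) →
             d ⊨ (𝒜 ↓ c) → (c ⨾ d) ⊨ 𝒜
    shift⁻ (cond ∀Q S) c d = shift-∀⁻ S c d
    shift⁻ (cond ∃Q S) c d = shift-∃⁻ S c d

    shift-∀⁺ : ∀ {A B C} (S : List (Branch A)) (c : Hom A B) (d : Hom B C) →
               ⊨∀ (c ⨾ d) S → ⊨∀ d (shiftList S c)
    shift-∀⁺ []            c d _ = tt
    shift-∀⁺ (br h 𝒜' ∷ S) c d (sat , satS) =
      ⊨∀-++⁺ (shiftSquares 𝒜' (κ h c)) (shiftList S c)
        (⊨∀-squares⁺ 𝒜' (κ h c) λ {_} {α} {β} m g d≡βg →
           shift⁺ 𝒜' α g (sat (α ⨾ g)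
             (trans (cong (c ⨾_) d≡βg) (sym (⨾-extend g (κ-commutes h c α β m))))))
        (shift-∀⁺ S c d satS)

    shift-∀⁻ : ∀ {A B C} (S : List (Branch A)) (c : Hom A B) (d : Hom B C) →
               ⊨∀ d (shiftList S c) → ⊨∀ (c ⨾ d) S
    shift-∀⁻ []            c d _ = tt
    shift-∀⁻ (br h 𝒜' ∷ S) c d sat
      with ⊨∀-++⁻ (shiftSquares 𝒜' (κ h c)) (shiftList S c) sat
    ... | satH , satS = satBranch , shift-∀⁻ S c d satS
      where
        satBranch : ∀ g → c ⨾ d ≡ h ⨾ g → g ⊨ 𝒜'
        satBranch g eq with κ-represents h c g d (sym eq)
        ... | _ , β₁ , β₂ , m , γ , g≡β₁γ , d≡β₂γ =
          subst (_⊨ 𝒜') (sym g≡β₁γ)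
            (shift⁻ 𝒜' β₁ γ (⊨∀-squares⁻ 𝒜' (κ h c) satH m γ d≡β₂γ))

    shift-∃⁺ : ∀ {A B C} (S : List (Branch A)) (c : Hom A B) (d : Hom B C) →
               ⊨∃ (c ⨾ d) S → ⊨∃ d (shiftList S c)
    shift-∃⁺ (br h 𝒜' ∷ S) c d (inj₁ (g , eq , s))
      with κ-represents h c g d (sym eq)
    ... | _ , β₁ , β₂ , m , γ , g≡β₁γ , d≡β₂γ =
      ⊨∃-++ˡ (shiftSquares 𝒜' (κ h c)) (shiftList S c)
        (⊨∃-squares⁺ 𝒜' (κ h c) m γ d≡β₂γ (shift⁺ 𝒜' β₁ γ (subst (_⊨ 𝒜') g≡β₁γ s)))
    shift-∃⁺ (br h 𝒜' ∷ S) c d (inj₂ satS) =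
      ⊨∃-++ʳ (shiftSquares 𝒜' (κ h c)) (shiftList S c) (shift-∃⁺ S c d satS)

    shift-∃⁻ : ∀ {A B C} (S : List (Branch A)) (c : Hom A B) (d : Hom B C) →
               ⊨∃ d (shiftList S c) → ⊨∃ (c ⨾ d) S
    shift-∃⁻ (br h 𝒜' ∷ S) c d sat
      with ⊨∃-++⁻ (shiftSquares 𝒜' (κ h c)) (shiftList S c) sat
    ... | inj₂ satS = inj₂ (shift-∃⁻ S c d satS)
    ... | inj₁ satH with ⊨∃-squares⁻ 𝒜' (κ h c) satH
    ...   | _ , α , β , m , g , d≡βg , s =
      inj₁ (α ⨾ g , trans (cong (c ⨾_) d≡βg) (sym (⨾-extend g (κ-commutes h c α β m))) ,
            shift⁻ 𝒜' α g s)

  ↓⨾-unfold : ∀ {A B D X} (𝒜 : Cond A) (c : Hom A B) (γ : Hom B D) (x : Hom D X) →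
              x ⊨ (𝒜 ↓ (c ⨾ γ)) → (γ ⨾ x) ⊨ (𝒜 ↓ c)
  ↓⨾-unfold 𝒜 c γ x s =
    shift⁺ 𝒜 c (γ ⨾ x) (subst (_⊨ 𝒜) (assoc c γ x) (shift⁻ 𝒜 (c ⨾ γ) x s))

  ↓⨾-fold : ∀ {A B D X} (𝒜 : Cond A) (c : Hom A B) (γ : Hom B D) (x : Hom D X) →
            (γ ⨾ x) ⊨ (𝒜 ↓ c) → x ⊨ (𝒜 ↓ (c ⨾ γ))
  ↓⨾-fold 𝒜 c γ x s =
    shift⁺ 𝒜 (c ⨾ γ) x (subst (_⊨ 𝒜) (sym (assoc c γ x)) (shift⁻ 𝒜 c (γ ⨾ x) s))

  module _ (𝒮 : ReactiveSystem) where

    representative⇒context : ∀ {J K} {a : Hom 𝟘 J} {f : Hom J K} {𝒜 : Cond K} {a' : Hom 𝟘 K} →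
                             RStep 𝒮 a f 𝒜 a' → CStep 𝒮 a f 𝒜 a'
    representative⇒context (I , ℓ' , r , ℛ , rule∈ , c , e₁ , e₂ , ent , _ , _) =
      I , ℓ' , r , ℛ , rule∈ , c , e₁ , e₂ , ent

    -- Context steps are closed under contexts: a step with label (f , ℬ)
    -- yields one with label (f⨾γ , ℬ↓γ), using the rule instance c⨾γ.
    step-in-context : ∀ {J D K} {b : Hom 𝟘 J} {f : Hom J D} {ℬ : Cond D} {b' : Hom 𝟘 D}
                      (γ : Hom D K) → CStep 𝒮 b f ℬ b' → CStep 𝒮 b (f ⨾ γ) (ℬ ↓ γ) (b' ⨾ γ)
    step-in-context {ℬ = ℬ} γ (I , ℓ' , r , ℛ , rule∈ , c , e₁ , refl , ent) =
      I , ℓ' , r , ℛ , rule∈ , c ⨾ γ , ⨾-extend γ e₁ , assoc r c γ ,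
      λ x s → ↓⨾-fold ℛ c γ x (ent (γ ⨾ x) (shift⁻ ℬ γ x s))

    record RepresentativeFactorisation {J K} (a : Hom 𝟘 J) (f : Hom J K)
                                       (𝒜 : Cond K) (a' : Hom 𝟘 K) : Set (o ⊔ ℓ) where
      field
        {D}      : Obj
        f'       : Hom J D
        𝒜'       : Cond D
        a''      : Hom 𝟘 D
        γ        : Hom D K
        rep-step : RStep 𝒮 a f' 𝒜' a''
        f≡f'γ    : f ≡ f' ⨾ γ
        a'≡a''γ  : a' ≡ a'' ⨾ γ
        entails  : ∀ {X} (x : Hom K X) → x ⊨ 𝒜 → (γ ⨾ x) ⊨ 𝒜'

    -- Every context step factors through a representative step, obtained
    -- from the representative square (f' , c') ∈ κ(a , ℓ) of a⨾f = ℓ⨾c.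
    factorise : ∀ {J K} {a : Hom 𝟘 J} {f : Hom J K} {𝒜 : Cond K} {a' : Hom 𝟘 K} →
                CStep 𝒮 a f 𝒜 a' → RepresentativeFactorisation a f 𝒜 a'
    factorise {a = a} {f} (I , ℓ' , r , ℛ , rule∈ , c , e₁ , refl , ent)
      with κ-represents a ℓ' f c e₁
    ... | _ , f' , c' , m , γ , f≡f'γ , refl = record
      { f'       = f'
      ; 𝒜'       = ℛ ↓ c'
      ; a''      = r ⨾ c'
      ; γ        = γ
      ; rep-step = I , ℓ' , r , ℛ , rule∈ , c' , κ-commutes a ℓ' f' c' m , refl ,
                   (λ x s → s) , m , refl
      ; f≡f'γ    = f≡f'γ
      ; a'≡a''γ  = sym (assoc r c' γ)
      ; entails  = λ x s → ↓⨾-unfold ℛ c' γ x (ent x s)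
      }

    record Extension (R : CRel 𝒮) {J K} (x y : Hom 𝟘 J) (𝒞 : Cond J)
                     (γ : Hom J K) : Set (o ⊔ ℓ) where
      field
        cond'   : Cond K
        related : R (triple K (x ⨾ γ) (y ⨾ γ) cond')
        implied : ∀ {X} (z : Hom K X) → (γ ⨾ z) ⊨ 𝒞 → z ⊨ cond'

    ContextClosed : CRel 𝒮 → Set (o ⊔ ℓ)
    ContextClosed R = ∀ {J K} {x y : Hom 𝟘 J} {𝒞 : Cond J} →
                      R (triple J x y 𝒞) → (γ : Hom J K) → Extension R x y 𝒞 γ

    -- u(R) is closed under contexts: the context d of a triple of u(R) is
    -- simply enlarged to d⨾γ.
    u-closed : (R : CRel 𝒮) → ContextClosed (u 𝒮 R)
    u-closed R (J , a , b , 𝒞 , inR , d , refl , refl , refl) γ = record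
      { cond'   = 𝒞 ↓ (d ⨾ γ)
      ; related = J , a , b , 𝒞 , inR , d ⨾ γ , assoc a d γ , assoc b d γ , refl
      ; implied = ↓⨾-fold 𝒞 d γ
      }

    -- The converse relation; the clause of f_C/f_R answering steps of b is
    -- the clause answering steps of a, taken for the converse relation.
    swap : CRel 𝒮 → CRel 𝒮
    swap R (triple J x y 𝒞) = R (triple J y x 𝒞)

    swap-closed : {R : CRel 𝒮} → ContextClosed R → ContextClosed (swap R)
    swap-closed closed inR γ = record
      { cond' = cond' ; related = related ; implied = implied }
      where open Extension (closed inR γ)

    answer-in-context : {R : CRel 𝒮} → ContextClosed R →
                        ∀ {J D K} {b : Hom 𝟘 J} {𝒞 : Cond J} {f : Hom J D}
                          {𝒜' : Cond D} {a' : Hom 𝟘 D} →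
                        AnsweredL 𝒮 R b 𝒞 f 𝒜' a' →
                        (γ : Hom D K) (𝒜 : Cond K) →
                        (∀ {X} (x : Hom K X) → x ⊨ 𝒜 → (γ ⨾ x) ⊨ 𝒜') →
                        AnsweredL 𝒮 R b 𝒞 (f ⨾ γ) 𝒜 (a' ⨾ γ)
    answer-in-context {R} closed {𝒞 = 𝒞} {f} {a' = a'}
                      (I , b' , ℬ , 𝒞' , steps , related , covers) γ 𝒜 𝒜⇒𝒜' =
      I , (λ i → b' i ⨾ γ) , (λ i → ℬ i ↓ γ) , (λ i → Extension.cond' (extend i)) ,
      (λ i → step-in-context {ℬ = ℬ i} γ (steps i)) , (λ i → Extension.related (extend i)) ,
      covers-in-context
      where
        extend : ∀ i → Extension R a' (b' i) (𝒞' i) γ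
        extend i = closed (related i) γ

        covers-in-context : EntailsBigOr 𝒮 𝒜 (𝒞 ↓ (f ⨾ γ)) I
                              (λ i → Extension.cond' (extend i)) (λ i → ℬ i ↓ γ)
        covers-in-context x x⊨𝒜 x⊨𝒞
          with covers (γ ⨾ x) (𝒜⇒𝒜' x x⊨𝒜) (↓⨾-unfold 𝒞 f γ x x⊨𝒞)
        ... | i , s𝒞' , sℬ = i , Extension.implied (extend i) x s𝒞' , shift⁺ (ℬ i) γ x sℬ

    representative-answers-suffice :
      {R : CRel 𝒮} → ContextClosed R →
      ∀ {J} {a b : Hom 𝟘 J} {𝒞 : Cond J} →
      (∀ {K} (f : Hom J K) (𝒜 : Cond K) (a' : Hom 𝟘 K) →
         RStep 𝒮 a f 𝒜 a' → AnsweredL 𝒮 R b 𝒞 f 𝒜 a') →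
      (∀ {K} (f : Hom J K) (𝒜 : Cond K) (a' : Hom 𝟘 K) →
         CStep 𝒮 a f 𝒜 a' → AnsweredL 𝒮 R b 𝒞 f 𝒜 a')
    representative-answers-suffice {R} closed {b = b} {𝒞} answer f 𝒜 a' step =
      subst₂ (λ g a'' → AnsweredL 𝒮 R b 𝒞 g 𝒜 a'') (sym f≡f'γ) (sym a'≡a''γ)
        (answer-in-context closed {𝒞 = 𝒞} {𝒜' = 𝒜'} (answer f' 𝒜' a'' rep-step) γ 𝒜 entails)
      where open RepresentativeFactorisation (factorise {𝒜 = 𝒜} step)

    fC⊆fR : (R : CRel 𝒮) (t : Triple 𝒮) → fC 𝒮 R t → fR 𝒮 R t
    fC⊆fR R (triple _ _ _ _) (answerA , answerB) =
      (λ f 𝒜 a' step → answerA f 𝒜 a' (representative⇒context step)) ,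
      (λ f ℬ b' step → answerB f ℬ b' (representative⇒context step))

    fR⊆fC : (R : CRel 𝒮) → ContextClosed R → (t : Triple 𝒮) → fR 𝒮 R t → fC 𝒮 R t
    fR⊆fC R closed (triple _ _ _ 𝒞) (answerA , answerB) =
      representative-answers-suffice closed {𝒞 = 𝒞} answerA ,
      representative-answers-suffice (swap-closed closed) {𝒞 = 𝒞} answerB

    fC∘u≐fR∘u : (R : CRel 𝒮) → _≐_ 𝒮 (fC 𝒮 (u 𝒮 R)) (fR 𝒮 (u 𝒮 R))
    fC∘u≐fR∘u R t = mk⇔ (fC⊆fR (u 𝒮 R) t) (fR⊆fC (u 𝒮 R) (u-closed R) t)

corollary5p15 : ∀ {o ℓ : Level} (𝒳 : Setting o ℓ) →
    let open Theory 𝒳 in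
    (𝒮 : ReactiveSystem) (R : CRel 𝒮) →
    _≐_ 𝒮 (fC 𝒮 (u 𝒮 R)) (fR 𝒮 (u 𝒮 R))
corollary5p15 𝒳 𝒮 R = fC∘u≐fR∘u 𝒳 𝒮 R
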